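{- Let $\Delta$ be a pure, strongly connected, $d$-dimensional simplicial complex on vertex set $[n]$ (with $d<n$ positive integers), and assume the natural order on $[n]$ is a unit interval order for $\Delta$. Then $\Delta$ is vertex decomposable.
   Context: A simplicial complex is a family of finite sets closed under taking subsets; faces, facets (maximal faces), dimension and purity are as usual. $\Delta$ is strongly connected if its dual graph (nodes = facets, edges between facets sharing a codimension-one face) is connected. The order on $[n]$ is a unit interval order for $\Delta$ if for every facet $\{v_0<v_1<\dots<v_d\}$ of $\Delta$, every $(d+1)$-element subset of $\{v_0,v_0+1,\dots,v_d\}$ is a face of $\Delta$. For a vertex $v$, $\mathrm{link}_\Delta(v)=\{E\in\Delta: v\notin E,\ E\cup\{v\}\in\Delta\}$ and $\mathrm{del}_\Delta(v)=\{E\in\Delta: v\notin E\}$. A pure complex $\Delta$ is vertex decomposable if either $\Delta$ is a simplex (all subsets of one set) or $\Delta=\{\varnothing\}$, or there is a vertex $v$ such that $\mathrm{link}_\Delta(v)$ and $\mathrm{del}_\Delta(v)$ are both vertex decomposable and every facet of $\mathrm{del}_\Delta(v)$ is a facet of $\Delta$. -}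

module Defs where

open import Data.Nat using (ℕ; suc; _≤_)
open import Data.Fin using (Fin; toℕ)
open import Data.Fin.Subset using (Subset; _∈_; _∉_; _⊆_; _∩_; _∪_; ⁅_⁆; ∣_∣; ⊥)
open import Data.Product using (Σ; ∃; _×_; _,_)
open import Data.Sum using (_⊎_)
open import Relation.Binary.PropositionalEquality using (_≡_)
open import Relation.Binary.Construct.Closure.ReflexiveTransitive using (Star)
open import Function.Bundles using (_⇔_)

-- A (candidate) family of faces on the vertex set [n], encoded as Fin n
-- (vertex i ↔ i+1, natural order preserved).
Complex : ℕ → Set₁
Complex n = Subset n → Set

IsSimplicialComplex : ∀ {n} → Complex n → Set
IsSimplicialComplex {n} Δ = Δ ⊥ × (∀ (E F : Subset n) → F ⊆ E → Δ E → Δ F)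

HasVertexSetAll : ∀ {n} → Complex n → Set
HasVertexSetAll {n} Δ = ∀ (i : Fin n) → Δ ⁅ i ⁆

IsFacet : ∀ {n} → Complex n → Subset n → Set
IsFacet {n} Δ F = Δ F × (∀ (G : Subset n) → Δ G → F ⊆ G → F ≡ G)

IsPure : ∀ {n} → Complex n → Set
IsPure {n} Δ = ∃ λ (k : ℕ) → ∀ (F : Subset n) → IsFacet Δ F → ∣ F ∣ ≡ k

IsPureOfDim : ∀ {n} → ℕ → Complex n → Set
IsPureOfDim {n} d Δ =
  (∃ λ (F : Subset n) → IsFacet Δ F) ×
  (∀ (F : Subset n) → IsFacet Δ F → ∣ F ∣ ≡ suc d)

ShareCodimOne : ∀ {n} → Subset n → Subset n → Set
ShareCodimOne F G = (suc ∣ F ∩ G ∣ ≡ ∣ F ∣) × (suc ∣ F ∩ G ∣ ≡ ∣ G ∣)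

DualEdge : ∀ {n} → Complex n → Subset n → Subset n → Set
DualEdge Δ F G = IsFacet Δ F × IsFacet Δ G × ShareCodimOne F G

StronglyConnected : ∀ {n} → Complex n → Set
StronglyConnected {n} Δ =
  ∀ (F G : Subset n) → IsFacet Δ F → IsFacet Δ G → Star (DualEdge Δ) F G

InSpan : ∀ {n} → Subset n → Subset n → Set
InSpan {n} F S =
  ∀ (x : Fin n) → x ∈ S →
    ∃ λ (a : Fin n) → ∃ λ (b : Fin n) →
      a ∈ F × b ∈ F × toℕ a ≤ toℕ x × toℕ x ≤ toℕ b

UnitIntervalOrder : ∀ {n} → Complex n → Set
UnitIntervalOrder {n} Δ =
  ∀ (F S : Subset n) → IsFacet Δ F → InSpan F S → ∣ S ∣ ≡ ∣ F ∣ → Δ S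

link : ∀ {n} → Complex n → Fin n → Complex n
link Δ v E = v ∉ E × Δ (E ∪ ⁅ v ⁆)

del : ∀ {n} → Complex n → Fin n → Complex n
del Δ v E = v ∉ E × Δ E

IsSimplex : ∀ {n} → Complex n → Set
IsSimplex {n} Δ = ∃ λ (S : Subset n) → ∀ (E : Subset n) → Δ E ⇔ (E ⊆ S)

IsEmptyFaceOnly : ∀ {n} → Complex n → Set
IsEmptyFaceOnly {n} Δ = ∀ (E : Subset n) → Δ E ⇔ (E ≡ ⊥)

data VertexDecomposable {n : ℕ} (Δ : Complex n) : Set₁ where
  vd-simplex : IsPure Δ → IsSimplex Δ → VertexDecomposable Δ
  vd-empty   : IsPure Δ → IsEmptyFaceOnly Δ → VertexDecomposable Δ
  vd-shed    : IsPure Δ → (v : Fin n) → Δ ⁅ v ⁆ →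
               VertexDecomposable (link Δ v) →
               VertexDecomposable (del Δ v) →
               (∀ (F : Subset n) → IsFacet (del Δ v) F → IsFacet Δ F) →
               VertexDecomposable Δ

{-# OPTIONS --safe #-}
-- For a facet F let span F = [min F, max F].  As [n] is a unit interval order, the faces of Δ
-- are exactly the sets of at most d + 1 vertices inside the span of some facet.  So Δ is an
-- interval complex: for a family J of intervals [a, b) with at least k points each, its faces
-- are the sets of at most k points inside a member of J.  Strong connectivity gives the facet
-- spans one more property: an interval with some member of J starting to its left is met in
-- at least k - 1 points by a member starting to its left (on a dual-graph path towards it, the
-- last facet reaching left of it shares k - 1 points with the next one).  Interval complexes
-- of such families are vertex decomposable, by induction on the largest right end m and on k.
-- If every interval is [m - k, m) the complex is a simplex.  Otherwise m - 1 is a shedding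
-- vertex: its link is the interval complex of rank k - 1 of the intervals ending at m,
-- shortened by one, and its deletion is the interval complex of rank k of the intervals cut
-- off at m - 1 that keep k points, which by the overlap property still cover all faces
-- avoiding m - 1.  The deletion is pure of dimension k - 1, so its facets are facets.

module Submission where

open import Defs
open import Data.Empty using (⊥-elim)
open import Data.Fin using (Fin; zero; suc; toℕ; fromℕ<)
open import Data.Fin.Properties using (toℕ-injective; toℕ<n; toℕ-fromℕ<; all?; any?)
open import Data.Fin.Subset
open import Data.Fin.Subset.Properties
open import Data.Fin.Subset.Induction using (⊃-wellFounded; Acc; acc)
open import Data.Nat using (ℕ; zero; suc; _+_; _∸_; _⊓_; _≤_; _<_; z≤n; s≤s; NonZero; >-nonZero⁻¹)
open import Data.Nat.Properties
open import Data.Product using (∃; ∃₂; _×_; _,_; proj₁; proj₂; swap; map₂)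
open import Data.Sum using (inj₁; inj₂)
open import Data.Vec using (_∷_; []; here; there)
open import Function using (_∘_)
open import Function.Bundles using (mk⇔; Equivalence)
open import Relation.Binary.Construct.Closure.ReflexiveTransitive using (Star; ε; _◅_)
open import Relation.Binary.PropositionalEquality using (_≡_; _≢_; refl; sym; trans; cong; subst)
open import Relation.Nullary using (Dec; yes; no; ¬_; contradiction)
open import Relation.Nullary.Decidable using (map′; _×-dec_; _→-dec_)
open import Relation.Unary using (Decidable; _≐_)

Intervals : Set₁
Intervals = ℕ → ℕ → Set

private
  variable
    n k m a b a₁ b₁ : ℕ
    E F S : Subset n
    Δ Δ′ : Complex n
    J : Intervals

-- Subsets of [n] and intervals

infix 4 _⊆[_,_⟩

_⊆[_,_⟩ : Subset n → ℕ → ℕ → Set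
E ⊆[ a , b ⟩ = ∀ {x} → x ∈ E → a ≤ toℕ x × toℕ x < b

_⊆[_,_⟩? : ∀ (E : Subset n) a b → Dec (E ⊆[ a , b ⟩)
E ⊆[ a , b ⟩? = map′ (λ h {x} → h x) (λ h x → h)
  (all? λ x → x ∈? E →-dec (a ≤? toℕ x ×-dec toℕ x <? b))

⊆[,⟩-mono : a₁ ≤ a → b ≤ b₁ → E ⊆[ a , b ⟩ → E ⊆[ a₁ , b₁ ⟩
⊆[,⟩-mono a₁≤a b≤b₁ E⊆ x∈E =
  let a≤x , x<b = E⊆ x∈E in ≤-trans a₁≤a a≤x , <-≤-trans x<b b≤b₁

⊆[,⟩-⊓ : E ⊆[ a , b ⟩ → E ⊆[ a , b₁ ⟩ → E ⊆[ a , b ⊓ b₁ ⟩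
⊆[,⟩-⊓ E⊆ E⊆′ x∈E = proj₁ (E⊆ x∈E) , ⊓-glb (proj₂ (E⊆ x∈E)) (proj₂ (E⊆′ x∈E))

⊆[,⟩-∪ : E ⊆[ a , b ⟩ → F ⊆[ a , b ⟩ → E ∪ F ⊆[ a , b ⟩
⊆[,⟩-∪ {E = E} {F = F} E⊆ F⊆ x∈E∪F with x∈p∪q⁻ E F x∈E∪F
... | inj₁ x∈E = E⊆ x∈E
... | inj₂ x∈F = F⊆ x∈F

⁅⁆-⊆[,⟩ : {x : Fin n} → a ≤ toℕ x → toℕ x < b → ⁅ x ⁆ ⊆[ a , b ⟩
⁅⁆-⊆[,⟩ {x = x} a≤x x<b y∈⁅x⁆ rewrite x∈⁅y⁆⇒x≡y x y∈⁅x⁆ = a≤x , x<b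

interval : ∀ n → ℕ → ℕ → Subset n
interval zero    _       _       = []
interval (suc n) _       zero    = ⊥
interval (suc n) zero    (suc b) = inside  ∷ interval n zero b
interval (suc n) (suc a) (suc b) = outside ∷ interval n a b

interval-⊆[,⟩ : ∀ a b → interval n a b ⊆[ a , b ⟩
interval-⊆[,⟩ {suc n} _       zero    x∈I = ⊥-elim (∉⊥ x∈I)
interval-⊆[,⟩ {suc n} zero    (suc b) here = z≤n , s≤s z≤n
interval-⊆[,⟩ {suc n} zero    (suc b) (there x∈I) = z≤n , s≤s (proj₂ (interval-⊆[,⟩ zero b x∈I))
interval-⊆[,⟩ {suc n} (suc a) (suc b) (there x∈I) =
  let a≤x , x<b = interval-⊆[,⟩ a b x∈I in s≤s a≤x , s≤s x<b

∈interval : ∀ {x : Fin n} a b → a ≤ toℕ x → toℕ x < b → x ∈ interval n a b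
∈interval {x = zero}  zero    (suc b) _         _         = here
∈interval {x = suc x} zero    (suc b) _         (s≤s x<b) = there (∈interval zero b z≤n x<b)
∈interval {x = suc x} (suc a) (suc b) (s≤s a≤x) (s≤s x<b) = there (∈interval a b a≤x x<b)

⊆[,⟩⇒⊆interval : E ⊆[ a , b ⟩ → E ⊆ interval n a b
⊆[,⟩⇒⊆interval {a = a} {b = b} E⊆ x∈E = let a≤x , x<b = E⊆ x∈E in ∈interval a b a≤x x<b

∣interval∣ : ∀ a b → b ≤ n → ∣ interval n a b ∣ ≡ b ∸ a
∣interval∣ {zero}  a       zero    _         = sym (0∸n≡0 a)
∣interval∣ {suc n} a       zero    _         = trans (∣⊥∣≡0 (suc n)) (sym (0∸n≡0 a))
∣interval∣ {suc n} zero    (suc b) (s≤s b≤n) = cong suc (∣interval∣ zero b b≤n)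
∣interval∣ {suc n} (suc a) (suc b) (s≤s b≤n) = ∣interval∣ a b b≤n

⊆[,⟩⇒∣∣≤∸ : {E : Subset n} → b ≤ n → E ⊆[ a , b ⟩ → ∣ E ∣ ≤ b ∸ a
⊆[,⟩⇒∣∣≤∸ {a = a} {E = E} b≤n E⊆ =
  subst (∣ E ∣ ≤_) (∣interval∣ a _ b≤n) (p⊆q⇒∣p∣≤∣q∣ (⊆[,⟩⇒⊆interval E⊆))

⊆[,⟩⇒∣∣+a≤b : {E : Subset n} → b ≤ n → 0 < ∣ E ∣ → E ⊆[ a , b ⟩ → ∣ E ∣ + a ≤ b
⊆[,⟩⇒∣∣+a≤b {E = E} b≤n 0<∣E∣ E⊆ = m≤o∸n⇒m+n≤o ∣ E ∣ (<⇒≤ a<b) ∣E∣≤b∸a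
  where
  ∣E∣≤b∸a = ⊆[,⟩⇒∣∣≤∸ b≤n E⊆
  a<b = m∸n≢0⇒n<m λ b∸a≡0 → <⇒≱ 0<∣E∣ (subst (∣ E ∣ ≤_) b∸a≡0 ∣E∣≤b∸a)

p⊆q∧p⊄q⇒p≡q : E ⊆ F → ¬ (E ⊂ F) → E ≡ F
p⊆q∧p⊄q⇒p≡q {E = E} {F = F} E⊆F E⊄F = ⊆-antisym E⊆F F⊆E
  where
  F⊆E : F ⊆ E
  F⊆E {x} x∈F with x ∈? E
  ... | yes x∈E = x∈E
  ... | no  x∉E = contradiction ((λ {y} → E⊆F {y}) , x , x∈F , x∉E) E⊄F

p⊆q∧∣q∣≤∣p∣⇒p≡q : E ⊆ F → ∣ F ∣ ≤ ∣ E ∣ → E ≡ F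
p⊆q∧∣q∣≤∣p∣⇒p≡q E⊆F ∣F∣≤∣E∣ = p⊆q∧p⊄q⇒p≡q E⊆F λ E⊂F → <⇒≱ (p⊂q⇒∣p∣<∣q∣ E⊂F) ∣F∣≤∣E∣

x∉p⇒∣p∪⁅x⁆∣≡1+∣p∣ : ∀ {x : Fin n} → x ∉ E → ∣ E ∪ ⁅ x ⁆ ∣ ≡ suc ∣ E ∣
x∉p⇒∣p∪⁅x⁆∣≡1+∣p∣ {E = inside  ∷ E} {zero}  x∉E = contradiction here x∉E
x∉p⇒∣p∪⁅x⁆∣≡1+∣p∣ {E = outside ∷ E} {zero}  _   = cong (suc ∘ ∣_∣) (∪-identityʳ E)
x∉p⇒∣p∪⁅x⁆∣≡1+∣p∣ {E = inside  ∷ E} {suc x} x∉E = cong suc (x∉p⇒∣p∪⁅x⁆∣≡1+∣p∣ (drop-not-there x∉E))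
x∉p⇒∣p∪⁅x⁆∣≡1+∣p∣ {E = outside ∷ E} {suc x} x∉E = x∉p⇒∣p∪⁅x⁆∣≡1+∣p∣ (drop-not-there x∉E)

extend-to-size : ∀ {E U : Subset n} → E ⊆ U → ∣ E ∣ ≤ k → k ≤ ∣ U ∣ →
                 ∃ λ S → E ⊆ S × S ⊆ U × ∣ S ∣ ≡ k
extend-to-size {k = zero} {E = []} {[]} _ _ _ = [] , (λ ()) , (λ ()) , refl
extend-to-size {E = inside  ∷ E} {outside ∷ U} E⊆U _ _ with () ← E⊆U here
extend-to-size {k = suc k} {E = inside  ∷ E} {inside  ∷ U} E⊆U (s≤s ∣E∣≤k) (s≤s k≤∣U∣) =
  let S , E⊆S , S⊆U , ∣S∣≡k = extend-to-size (drop-∷-⊆ E⊆U) ∣E∣≤k k≤∣U∣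
  in inside ∷ S , s⊆s E⊆S , s⊆s S⊆U , cong suc ∣S∣≡k
extend-to-size {E = outside ∷ E} {outside ∷ U} E⊆U ∣E∣≤k k≤∣U∣ =
  let S , E⊆S , S⊆U , ∣S∣≡k = extend-to-size (drop-∷-⊆ E⊆U) ∣E∣≤k k≤∣U∣
  in outside ∷ S , s⊆s E⊆S , s⊆s S⊆U , ∣S∣≡k
extend-to-size {k = k} {E = outside ∷ E} {inside  ∷ U} E⊆U ∣E∣≤k k≤1+∣U∣ with k ≤? ∣ U ∣
... | yes k≤∣U∣ =
  let S , E⊆S , S⊆U , ∣S∣≡k = extend-to-size (drop-∷-⊆ E⊆U) ∣E∣≤k k≤∣U∣
  in outside ∷ S , s⊆s E⊆S , out⊆ S⊆U , ∣S∣≡k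
... | no  k≰∣U∣ = inside ∷ U , out⊆ (drop-∷-⊆ E⊆U) , ⊆-refl , ≤-antisym (≰⇒> k≰∣U∣) k≤1+∣U∣

⊆[,⟩-extend : {E : Subset n} → k + a ≤ b → b ≤ n → ∣ E ∣ ≤ k → E ⊆[ a , b ⟩ →
              ∃ λ S → E ⊆ S × S ⊆[ a , b ⟩ × ∣ S ∣ ≡ k
⊆[,⟩-extend {k = k} {a = a} {b = b} k+a≤b b≤n ∣E∣≤k E⊆ =
  let S , E⊆S , S⊆I , ∣S∣≡k = extend-to-size (⊆[,⟩⇒⊆interval E⊆) ∣E∣≤k k≤∣I∣
  in S , E⊆S , (λ x∈S → interval-⊆[,⟩ a b (S⊆I x∈S)) , ∣S∣≡k
  where
  k≤∣I∣ = subst (k ≤_) (sym (∣interval∣ a b b≤n)) (m+n≤o⇒m≤o∸n k k+a≤b)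

∃-min : Nonempty E → ∃ λ x → x ∈ E × ∀ {y} → y ∈ E → toℕ x ≤ toℕ y
∃-min {E = inside  ∷ E} _                  = zero , here , λ _ → z≤n
∃-min {E = outside ∷ E} (suc y , there y∈E) =
  let x , x∈E , x-min = ∃-min (y , y∈E)
  in suc x , there x∈E , λ { {suc z} (there z∈E) → s≤s (x-min z∈E) }

∃-max : Nonempty E → ∃ λ y → y ∈ E × ∀ {x} → x ∈ E → toℕ x ≤ toℕ y
∃-max {E = s ∷ E} ne with nonempty? E
... | yes ne′ =
  let y , y∈E , y-max = ∃-max ne′
  in suc y , there y∈E , λ { {zero} _ → z≤n ; {suc x} (there x∈E) → s≤s (y-max x∈E) }
... | no ∅E with ne
...   | suc x , there x∈E = contradiction (x , x∈E) ∅E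
...   | zero  , here        =
  zero , here , λ { {zero} _ → z≤n ; {suc x} (there x∈E) → contradiction (x , x∈E) ∅E }

-- Facets, and complexes with the same faces

IsFacet-resp-≐ : Δ ≐ Δ′ → IsFacet Δ F → IsFacet Δ′ F
IsFacet-resp-≐ (Δ⊆Δ′ , Δ′⊆Δ) (ΔF , maximal) = Δ⊆Δ′ ΔF , λ G Δ′G → maximal G (Δ′⊆Δ Δ′G)

IsPure-resp-≐ : Δ ≐ Δ′ → IsPure Δ → IsPure Δ′
IsPure-resp-≐ Δ≐Δ′ (k , pure) = k , λ F F-facet → pure F (IsFacet-resp-≐ (swap Δ≐Δ′) F-facet)

IsSimplex-resp-≐ : Δ ≐ Δ′ → IsSimplex Δ → IsSimplex Δ′
IsSimplex-resp-≐ (Δ⊆Δ′ , Δ′⊆Δ) (S , Δ⇔⊆S) =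
  S , λ E → mk⇔ (Equivalence.to (Δ⇔⊆S E) ∘ Δ′⊆Δ) (Δ⊆Δ′ ∘ Equivalence.from (Δ⇔⊆S E))

IsEmptyFaceOnly-resp-≐ : Δ ≐ Δ′ → IsEmptyFaceOnly Δ → IsEmptyFaceOnly Δ′
IsEmptyFaceOnly-resp-≐ (Δ⊆Δ′ , Δ′⊆Δ) Δ⇔≡⊥ =
  λ E → mk⇔ (Equivalence.to (Δ⇔≡⊥ E) ∘ Δ′⊆Δ) (Δ⊆Δ′ ∘ Equivalence.from (Δ⇔≡⊥ E))

link-resp-≐ : ∀ v → Δ ≐ Δ′ → link Δ v ≐ link Δ′ v
link-resp-≐ _ (Δ⊆Δ′ , Δ′⊆Δ) = map₂ Δ⊆Δ′ , map₂ Δ′⊆Δ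

del-resp-≐ : ∀ v → Δ ≐ Δ′ → del Δ v ≐ del Δ′ v
del-resp-≐ _ (Δ⊆Δ′ , Δ′⊆Δ) = map₂ Δ⊆Δ′ , map₂ Δ′⊆Δ

VertexDecomposable-resp-≐ : Δ ≐ Δ′ → VertexDecomposable Δ → VertexDecomposable Δ′
VertexDecomposable-resp-≐ Δ≐Δ′ (vd-simplex pure simplex) =
  vd-simplex (IsPure-resp-≐ Δ≐Δ′ pure) (IsSimplex-resp-≐ Δ≐Δ′ simplex)
VertexDecomposable-resp-≐ Δ≐Δ′ (vd-empty pure empty) =
  vd-empty (IsPure-resp-≐ Δ≐Δ′ pure) (IsEmptyFaceOnly-resp-≐ Δ≐Δ′ empty)
VertexDecomposable-resp-≐ Δ≐Δ′ (vd-shed pure v Δv link-vd del-vd del-facets) =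
  vd-shed (IsPure-resp-≐ Δ≐Δ′ pure) v (proj₁ Δ≐Δ′ Δv)
    (VertexDecomposable-resp-≐ (link-resp-≐ v Δ≐Δ′) link-vd)
    (VertexDecomposable-resp-≐ (del-resp-≐ v Δ≐Δ′) del-vd)
    (λ F F-facet → IsFacet-resp-≐ Δ≐Δ′
       (del-facets F (IsFacet-resp-≐ (del-resp-≐ v (swap Δ≐Δ′)) F-facet)))

ProperSuperface : Complex n → Subset n → Set
ProperSuperface Δ F = ∃ λ G → Δ G × F ⊂ G

¬ProperSuperface⇒IsFacet : Δ F → ¬ ProperSuperface Δ F → IsFacet Δ F
¬ProperSuperface⇒IsFacet ΔF ∄G =
  ΔF , λ G ΔG F⊆G → p⊆q∧p⊄q⇒p≡q F⊆G λ F⊂G → ∄G (G , ΔG , F⊂G)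

isFacet? : Decidable Δ → Decidable (IsFacet Δ)
isFacet? Δ? F with Δ? F | anySubset? (λ G → Δ? G ×-dec F ⊂? G)
... | no ¬ΔF | _                  = no (¬ΔF ∘ proj₁)
... | yes _  | yes (G , ΔG , F⊂G) = no λ (_ , maximal) → ⊂-irref (maximal G ΔG (proj₁ F⊂G)) F⊂G
... | yes ΔF | no ∄G              = yes (¬ProperSuperface⇒IsFacet ΔF ∄G)

∃-facet-⊇ : Decidable Δ → Δ E → ∃ λ F → IsFacet Δ F × E ⊆ F
∃-facet-⊇ {Δ = Δ} Δ? = go (⊃-wellFounded _)
  where
  go : Acc _⊃_ E → Δ E → ∃ λ F → IsFacet Δ F × E ⊆ F
  go {E} (acc larger) ΔE with anySubset? (λ G → Δ? G ×-dec E ⊂? G)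
  ... | no ∄G = E , ¬ProperSuperface⇒IsFacet ΔE ∄G , ⊆-refl
  ... | yes (G , ΔG , E⊂G) =
    let F , F-facet , G⊆F = go (larger E⊂G) ΔG in F , F-facet , ⊆-trans (p⊂q⇒p⊆q E⊂G) G⊆F

maximum-size⇒IsFacet : Δ F → (∀ {G} → Δ G → ∣ G ∣ ≤ ∣ F ∣) → IsFacet Δ F
maximum-size⇒IsFacet ΔF maximum = ΔF , λ G ΔG F⊆G → p⊆q∧∣q∣≤∣p∣⇒p≡q F⊆G (maximum ΔG)

-- Interval complexes

IntervalComplex : ℕ → Intervals → Complex n
IntervalComplex k J E = ∣ E ∣ ≤ k × ∃₂ λ a b → J a b × E ⊆[ a , b ⟩

record IntervalFamily (n k m : ℕ) (J : Intervals) : Set where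
  field
    long                 : ∀ {a b} → J a b → k + a ≤ b
    bounded              : ∀ {a b} → J a b → b ≤ m
    m≤n                  : m ≤ n
    -- [a′, b′) starts left of a and contains at least k - 1 points of [a, ∞)
    overlapped-from-left : ∀ {a b a₁ b₁} → J a b → J a₁ b₁ → a₁ < a →
                           ∃₂ λ a′ b′ → J a′ b′ × a′ < a × k + a ≤ suc b′
    nonempty             : ∃₂ J
    decidable            : ∀ a b → Dec (J a b)

module _ (𝓙 : IntervalFamily n k m J) where
  open IntervalFamily 𝓙

  IntervalComplex-facet-size : {F : Subset n} → IsFacet (IntervalComplex k J) F → ∣ F ∣ ≡ k
  IntervalComplex-facet-size ((∣F∣≤k , a , b , j , F⊆) , maximal) =
    let S , F⊆S , S⊆ , ∣S∣≡k = ⊆[,⟩-extend (long j) (≤-trans (bounded j) m≤n) ∣F∣≤k F⊆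
    in trans (cong ∣_∣ (maximal S (≤-reflexive ∣S∣≡k , a , b , j , S⊆) F⊆S)) ∣S∣≡k

  IntervalComplex-pure : IsPure (IntervalComplex {n} k J)
  IntervalComplex-pure = k , λ _ → IntervalComplex-facet-size

  ∃-ending-at? : ∀ b → Dec (∃ λ a → J a b)
  ∃-ending-at? b = map′ (λ (a , _ , j) → a , j) (λ (a , j) → a , s≤s (m+n≤o⇒n≤o k (long j)) , j)
    (anyUpTo? (λ a → decidable a b) (suc b))

  ∃-k+a<m? : Dec (∃₂ λ a b → J a b × k + a < m)
  ∃-k+a<m? = map′ (λ (a , _ , b , _ , short) → a , b , short)
    (λ (a , b , j , k+a<m) → a , s≤s (m+n≤o⇒n≤o k (<⇒≤ k+a<m)) ,
                            b , s≤s (bounded j) , j , k+a<m)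
    (anyUpTo? (λ a → anyUpTo? (λ b → decidable a b ×-dec k + a <? m) (suc m)) (suc m))

IntervalComplex-only-∅ : ∃₂ J → IsEmptyFaceOnly (IntervalComplex {n} 0 J)
IntervalComplex-only-∅ {n = n} (a , b , j) E = mk⇔ to from
  where
  to : IntervalComplex 0 _ E → E ≡ ⊥
  to (∣E∣≤0 , _) = sym (p⊆q∧∣q∣≤∣p∣⇒p≡q (⊆-min E) (subst (∣ E ∣ ≤_) (sym (∣⊥∣≡0 n)) ∣E∣≤0))
  from : E ≡ ⊥ → IntervalComplex 0 _ E
  from refl = ≤-reflexive (∣⊥∣≡0 n) , a , b , j , λ x∈⊥ → ⊥-elim (∉⊥ x∈⊥)

¬IntervalFamily-bound-0 : ¬ IntervalFamily n (suc k) 0 J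
¬IntervalFamily-bound-0 𝓙 with _ , _ , j ← IntervalFamily.nonempty 𝓙
  with () ← ≤-trans (IntervalFamily.long 𝓙 j) (IntervalFamily.bounded 𝓙 j)

IntervalFamily-lower-bound : IntervalFamily n k (suc m) J → ¬ (∃ λ a → J a (suc m)) →
                             IntervalFamily n k m J
IntervalFamily-lower-bound {m = m} {J = J} 𝓙 ∄top = record
  { long                 = long
  ; bounded              = λ {a} j →
                             ≤-pred (≤∧≢⇒< (bounded j) λ b≡1+m → ∄top (a , subst (J a) b≡1+m j))
  ; m≤n                  = ≤-trans (n≤1+n m) m≤n
  ; overlapped-from-left = overlapped-from-left
  ; nonempty             = nonempty
  ; decidable            = decidable
  }
  where open IntervalFamily 𝓙

IntervalComplex-simplex : {a₀ : ℕ} → IntervalFamily n k (suc m) J → J a₀ (suc m) →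
                          ¬ (∃₂ λ a b → J a b × k + a < suc m) → IsSimplex (IntervalComplex {n} k J)
IntervalComplex-simplex {n = n} {k = k} {m = m} {J = J} {a₀ = a₀} 𝓙 top ∄short =
  interval n a₀ (suc m) , λ E → mk⇔ to from
  where
  open IntervalFamily 𝓙
  reaches-top : ∀ {a b} → J a b → suc m ≤ k + a
  reaches-top j = ≮⇒≥ λ short → ∄short (_ , _ , j , short)
  to : {E : Subset n} → IntervalComplex k J E → E ⊆ interval n a₀ (suc m)
  to (_ , a , b , j , E⊆) = ⊆[,⟩⇒⊆interval (⊆[,⟩-mono a₀≤a (bounded j) E⊆)
    where a₀≤a = +-cancelˡ-≤ k a₀ a (≤-trans (long top) (reaches-top j))
  from : {E : Subset n} → E ⊆ interval n a₀ (suc m) → IntervalComplex k J E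
  from {E} E⊆I = ∣E∣≤k , a₀ , suc m , top , E⊆
    where
    E⊆ : E ⊆[ a₀ , suc m ⟩
    E⊆ x∈E = interval-⊆[,⟩ a₀ (suc m) (E⊆I x∈E)
    open ≤-Reasoning
    ∣E∣≤k = begin
      ∣ E ∣         ≤⟨ ⊆[,⟩⇒∣∣≤∸ m≤n E⊆ ⟩
      suc m ∸ a₀   ≤⟨ ∸-monoˡ-≤ a₀ (reaches-top top) ⟩
      k + a₀ ∸ a₀  ≡⟨ m+n∸n≡m k a₀ ⟩
      k            ∎

LinkFamily : Intervals → ℕ → Intervals
LinkFamily J m a b = b ≡ m × J a (suc m)

DeletionFamily : ℕ → Intervals → ℕ → Intervals
DeletionFamily k J m a b = k + a ≤ b × ∃ λ b₀ → J a b₀ × b ≡ b₀ ⊓ m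

module Shedding (𝓙 : IntervalFamily n (suc k) (suc m) J)
                (v : Fin n) (v≡m : toℕ v ≡ m) where
  open IntervalFamily 𝓙

  ⊆[,m⟩⇒v∉ : {E : Subset n} → E ⊆[ a , m ⟩ → v ∉ E
  ⊆[,m⟩⇒v∉ E⊆ v∈E = <-irrefl v≡m (proj₂ (E⊆ v∈E))

  ⊆[,⟩-drop-v : {E : Subset n} → v ∉ E → E ⊆[ a , suc m ⟩ → E ⊆[ a , m ⟩
  ⊆[,⟩-drop-v {E = E} v∉E E⊆ {x} x∈E = proj₁ (E⊆ x∈E) , ≤∧≢⇒< (≤-pred (proj₂ (E⊆ x∈E))) x≢m
    where
    x≢m : toℕ x ≢ m
    x≢m x≡m = v∉E (subst (_∈ E) (toℕ-injective (trans x≡m (sym v≡m))) x∈E)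

  ⁅v⁆-⊆[,1+m⟩ : J a (suc m) → ⁅ v ⁆ ⊆[ a , suc m ⟩
  ⁅v⁆-⊆[,1+m⟩ j = ⁅⁆-⊆[,⟩ (subst (_ ≤_) (sym v≡m) a≤m) (s≤s (≤-reflexive v≡m))
    where a≤m = m+n≤o⇒n≤o k (≤-pred (long j))

  v-face : J a (suc m) → IntervalComplex (suc k) J ⁅ v ⁆
  v-face j = subst (_≤ suc k) (sym (∣⁅x⁆∣≡1 v)) (s≤s z≤n) , _ , _ , j , ⁅v⁆-⊆[,1+m⟩ j

  link≐ : link (IntervalComplex (suc k) J) v ≐ IntervalComplex k (LinkFamily J m)
  link≐ = to , from
    where
    to : {E : Subset n} → link (IntervalComplex (suc k) J) v E →
         IntervalComplex k (LinkFamily J m) E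
    to {E} (v∉E , ∣E∪v∣≤1+k , a , b , j , E∪v⊆) =
      ∣E∣≤k , a , m , (refl , subst (J a) b≡1+m j) ,
      ⊆[,⟩-drop-v v∉E (⊆[,⟩-mono ≤-refl (bounded j) λ x∈E → E∪v⊆ (p⊆p∪q ⁅ v ⁆ x∈E))
      where
      ∣E∣≤k = ≤-pred (subst (_≤ suc k) (x∉p⇒∣p∪⁅x⁆∣≡1+∣p∣ v∉E) ∣E∪v∣≤1+k)
      b≡1+m = ≤-antisym (bounded j) (subst (_< b) v≡m (proj₂ (E∪v⊆ (x∈p∪q⁺ (inj₂ (x∈⁅x⁆ v))))))
    from : {E : Subset n} → IntervalComplex k (LinkFamily J m) E →
           link (IntervalComplex (suc k) J) v E
    from (∣E∣≤k , a , _ , (refl , j) , E⊆) =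
      ⊆[,m⟩⇒v∉ E⊆ , subst (_≤ suc k) (sym (x∉p⇒∣p∪⁅x⁆∣≡1+∣p∣ (⊆[,m⟩⇒v∉ E⊆))) (s≤s ∣E∣≤k) ,
      a , suc m , j , ⊆[,⟩-∪ (⊆[,⟩-mono ≤-refl (n≤1+n m) E⊆) (⁅v⁆-⊆[,1+m⟩ j)

  linkFamily : {a₀ : ℕ} → J a₀ (suc m) → IntervalFamily n k m (LinkFamily J m)
  linkFamily {a₀} top = record
    { long                 = λ { (refl , j) → ≤-pred (long j) }
    ; bounded              = λ { (refl , _) → ≤-refl }
    ; m≤n                  = ≤-trans (n≤1+n m) m≤n
    ; overlapped-from-left = λ { (refl , j) (refl , j₁) a₁<a →
                                 _ , m , (refl , j₁) , a₁<a , m≤n⇒m≤1+n (≤-pred (long j)) }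
    ; nonempty             = a₀ , m , refl , top
    ; decidable            = λ a b → b ≟ m ×-dec decidable a (suc m)
    }

  truncate : J a b → suc k + a ≤ m → DeletionFamily (suc k) J m a (b ⊓ m)
  truncate {b = b} j fits = ⊓-glb (long j) fits , b , j , refl

  module _ (j₁ : J a₁ b₁) (short₁ : suc k + a₁ < suc m) where

    del≐ : del (IntervalComplex (suc k) J) v ≐
           IntervalComplex (suc k) (DeletionFamily (suc k) J m)
    del≐ = to , from
      where
      ∃-deletion-interval : {E : Subset n} → J a b → E ⊆[ a , b ⟩ → E ⊆[ a , m ⟩ →
                            ∃₂ λ a′ b′ → DeletionFamily (suc k) J m a′ b′ × E ⊆[ a′ , b′ ⟩
      ∃-deletion-interval {a = a} j E⊆ E⊆[a,m⟩ with suc k + a ≤? m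
      ... | yes fits = a , _ , truncate j fits , ⊆[,⟩-⊓ E⊆ E⊆[a,m⟩
      ... | no ¬fits =
        -- b = m + 1 and [a, b) has just suc k points, too few once cut at m; use [a′, b′ ⊓ m) instead
        let a′ , b′ , j′ , a′<a , 1+k+a≤1+b′ = overlapped-from-left j j₁ a₁<a
            fits′ = ≤-pred (<-≤-trans (+-monoʳ-< (suc k) a′<a) (≤-trans (long j) (bounded j)))
            m≤b′ = ≤-pred (≤-trans (≰⇒> ¬fits) 1+k+a≤1+b′)
        in a′ , b′ ⊓ m , truncate j′ fits′ , ⊆[,⟩-mono (<⇒≤ a′<a) (⊓-glb m≤b′ ≤-refl) E⊆[a,m⟩
        where a₁<a = +-cancelˡ-< (suc k) a₁ a (<-≤-trans short₁ (≰⇒> ¬fits))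
      to : {E : Subset n} → del (IntervalComplex (suc k) J) v E →
           IntervalComplex (suc k) (DeletionFamily (suc k) J m) E
      to (v∉E , ∣E∣≤1+k , a , b , j , E⊆) =
        ∣E∣≤1+k , ∃-deletion-interval j E⊆ (⊆[,⟩-drop-v v∉E (⊆[,⟩-mono ≤-refl (bounded j) E⊆))
      from : {E : Subset n} → IntervalComplex (suc k) (DeletionFamily (suc k) J m) E →
             del (IntervalComplex (suc k) J) v E
      from (∣E∣≤1+k , a , _ , (_ , b₀ , j , refl) , E⊆) =
        ⊆[,m⟩⇒v∉ (⊆[,⟩-mono ≤-refl (m⊓n≤n b₀ m) E⊆) ,
        ∣E∣≤1+k , a , b₀ , j , ⊆[,⟩-mono ≤-refl (m⊓n≤m b₀ m) E⊆

    deletionFamily : IntervalFamily n (suc k) m (DeletionFamily (suc k) J m)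
    deletionFamily = record
      { long                 = proj₁
      ; bounded              = λ { (_ , b₀ , _ , refl) → m⊓n≤n b₀ m }
      ; m≤n                  = ≤-trans (n≤1+n m) m≤n
      ; overlapped-from-left = deletion-overlapped-from-left
      ; nonempty             = a₁ , b₁ ⊓ m , truncate j₁ (≤-pred short₁)
      ; decidable            = λ a b → suc k + a ≤? b ×-dec ∃-untruncated? a b
      }
      where
      deletion-overlapped-from-left :
        ∀ {a b a₂ b₂} → DeletionFamily (suc k) J m a b → DeletionFamily (suc k) J m a₂ b₂ → a₂ < a →
        ∃₂ λ a′ b′ → DeletionFamily (suc k) J m a′ b′ × a′ < a × suc k + a ≤ suc b′
      deletion-overlapped-from-left (1+k+a≤b , b₀ , j , refl) (_ , _ , j₂ , _) a₂<a =
        let a′ , b′ , j′ , a′<a , 1+k+a≤1+b′ = overlapped-from-left j j₂ a₂<a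
            1+k+a≤m = ≤-trans 1+k+a≤b (m⊓n≤n b₀ m)
            fits′ = ≤-pred (<-≤-trans (+-monoʳ-< (suc k) a′<a) (m≤n⇒m≤1+n 1+k+a≤m))
        in a′ , b′ ⊓ m , truncate j′ fits′ , a′<a , ⊓-glb 1+k+a≤1+b′ (m≤n⇒m≤1+n 1+k+a≤m)
      ∃-untruncated? : ∀ a b → Dec (∃ λ b₀ → J a b₀ × b ≡ b₀ ⊓ m)
      ∃-untruncated? a b =
        map′ (λ (b₀ , _ , b≡) → b₀ , b≡) (λ (b₀ , j , b≡) → b₀ , s≤s (bounded j) , j , b≡)
          (anyUpTo? (λ b₀ → decidable a b₀ ×-dec b ≟ b₀ ⊓ m) (suc (suc m)))

    del-facets : ∀ F → IsFacet (del (IntervalComplex (suc k) J) v) F →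
                 IsFacet (IntervalComplex (suc k) J) F
    del-facets F F-facet =
      maximum-size⇒IsFacet (proj₂ (proj₁ F-facet)) λ (∣G∣≤1+k , _) →
        subst (_ ≤_) (sym ∣F∣≡1+k) ∣G∣≤1+k
      where ∣F∣≡1+k = IntervalComplex-facet-size deletionFamily (IsFacet-resp-≐ del≐ F-facet)

IntervalComplex-vertexDecomposable : ∀ m k → IntervalFamily n k m J →
                                     VertexDecomposable (IntervalComplex {n} k J)
IntervalComplex-vertexDecomposable m zero 𝓙 =
  vd-empty (IntervalComplex-pure 𝓙) (IntervalComplex-only-∅ (IntervalFamily.nonempty 𝓙))
IntervalComplex-vertexDecomposable zero (suc k) 𝓙 = contradiction 𝓙 ¬IntervalFamily-bound-0
IntervalComplex-vertexDecomposable (suc m) (suc k) 𝓙 with ∃-ending-at? 𝓙 (suc m)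
... | no ∄top = IntervalComplex-vertexDecomposable m (suc k) (IntervalFamily-lower-bound 𝓙 ∄top)
... | yes (a₀ , top) with ∃-k+a<m? 𝓙
...   | no ∄short = vd-simplex (IntervalComplex-pure 𝓙) (IntervalComplex-simplex 𝓙 top ∄short)
...   | yes (a₁ , b₁ , j₁ , short₁) =
  vd-shed (IntervalComplex-pure 𝓙) v (v-face top)
    (VertexDecomposable-resp-≐ (swap link≐)
      (IntervalComplex-vertexDecomposable m k (linkFamily top)))
    (VertexDecomposable-resp-≐ (swap (del≐ j₁ short₁))
      (IntervalComplex-vertexDecomposable m (suc k) (deletionFamily j₁ short₁)))
    (del-facets j₁ short₁)
  where
  v = fromℕ< (IntervalFamily.m≤n 𝓙)
  open Shedding 𝓙 v (toℕ-fromℕ< _)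

-- Facet spans

IsSpan : Subset n → ℕ → ℕ → Set
IsSpan F a b = F ⊆[ a , b ⟩ × (∃ λ x → x ∈ F × toℕ x ≡ a) × (∃ λ y → y ∈ F × suc (toℕ y) ≡ b)

isSpan? : ∀ (F : Subset n) a b → Dec (IsSpan F a b)
isSpan? F a b = F ⊆[ a , b ⟩? ×-dec any? (λ x → x ∈? F ×-dec toℕ x ≟ a)
                              ×-dec any? (λ y → y ∈? F ×-dec suc (toℕ y) ≟ b)

∃-span : Nonempty F → ∃₂ (IsSpan F)
∃-span ne with x , x∈F , x-min ← ∃-min ne | y , y∈F , y-max ← ∃-max ne =
  toℕ x , suc (toℕ y) , (λ z∈F → x-min z∈F , s≤s (y-max z∈F)) , (x , x∈F , refl) , (y , y∈F , refl)

IsSpan-bounded : {F : Subset n} → IsSpan F a b → b ≤ n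
IsSpan-bounded (_ , _ , y , _ , refl) = toℕ<n y

IsSpan⇒InSpan : IsSpan F a b → S ⊆[ a , b ⟩ → InSpan F S
IsSpan⇒InSpan (_ , (x , x∈F , refl) , (y , y∈F , refl)) S⊆ z z∈S =
  x , y , x∈F , y∈F , map₂ ≤-pred (S⊆ z∈S)

module FacetSpans {n d : ℕ} (Δ : Complex n) (Δ? : Decidable Δ)
                  (facet-size : ∀ F → IsFacet Δ F → ∣ F ∣ ≡ suc d) where

  FacetSpan : ℕ → ℕ → Set
  FacetSpan a b = ∃ λ F → IsFacet Δ F × IsSpan F a b

  facet-span : {F : Subset n} → IsFacet Δ F → ∃₂ (IsSpan F)
  facet-span {F} F-facet with nonempty? F
  ... | yes ne = ∃-span ne
  ... | no  ∅F
    with () ← trans (sym (facet-size F F-facet)) (trans (cong ∣_∣ (Empty-unique ∅F)) (∣⊥∣≡0 n))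

  facet-long : {F : Subset n} → IsFacet Δ F → IsSpan F a b → suc d + a ≤ b
  facet-long {F = F} F-facet F-span@(F⊆ , _) =
    subst (λ s → s + _ ≤ _) (facet-size F F-facet)
      (⊆[,⟩⇒∣∣+a≤b (IsSpan-bounded F-span) (subst (0 <_) (sym (facet-size F F-facet)) (s≤s z≤n)) F⊆)

  Δ≐IntervalComplex : (∀ E F → F ⊆ E → Δ E → Δ F) → UnitIntervalOrder Δ →
                      Δ ≐ IntervalComplex (suc d) FacetSpan
  Δ≐IntervalComplex closed unit-interval = to , from
    where
    to : {E : Subset n} → Δ E → IntervalComplex (suc d) FacetSpan E
    to {E} ΔE with F , F-facet , E⊆F ← ∃-facet-⊇ Δ? ΔE with a , b , F-span ← facet-span F-facet =
      subst (∣ E ∣ ≤_) (facet-size F F-facet) (p⊆q⇒∣p∣≤∣q∣ E⊆F) ,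
      a , b , (F , F-facet , F-span) , λ x∈E → proj₁ F-span (E⊆F x∈E)
    from : {E : Subset n} → IntervalComplex (suc d) FacetSpan E → Δ E
    from {E} (∣E∣≤1+d , a , b , (F , F-facet , F-span) , E⊆)
      with S , E⊆S , S⊆ , ∣S∣≡1+d ←
             ⊆[,⟩-extend (facet-long F-facet F-span) (IsSpan-bounded F-span) ∣E∣≤1+d E⊆ =
      closed S E E⊆S (unit-interval F S F-facet (IsSpan⇒InSpan F-span S⊆)
                        (trans ∣S∣≡1+d (sym (facet-size F F-facet))))

  overlapped-from-left : NonZero d → StronglyConnected Δ →
                         FacetSpan a b → FacetSpan a₁ b₁ → a₁ < a →
                         ∃₂ λ a′ b′ → FacetSpan a′ b′ × a′ < a × suc d + a ≤ suc b′
  overlapped-from-left {a = a} d≢0 connected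
    (F , F-facet , F⊆ , _) (F₁ , F₁-facet , _ , (x , x∈F₁ , refl) , _) a₁<a =
    walk F₁-facet (x , x∈F₁ , a₁<a) (connected F₁ F F₁-facet F-facet)
    where
    Below : Subset n → Set
    Below G = ∃ λ x → x ∈ G × toℕ x < a
    -- the last facet on the path with a vertex below a shares d vertices, all ≥ a, with the next
    walk : {G : Subset n} → IsFacet Δ G → Below G → Star (DualEdge Δ) G F →
           ∃₂ λ a′ b′ → FacetSpan a′ b′ × a′ < a × suc d + a ≤ suc b′
    walk _ (x , x∈F , x<a) ε = contradiction (proj₁ (F⊆ x∈F)) (<⇒≱ x<a)
    walk {G} G-facet (y , y∈G , y<a) (_◅_ {j = G′} (_ , G′-facet , shared , _) path)
      with any? (λ x → x ∈? G′ ×-dec toℕ x <? a)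
    ... | yes G′-below = walk G′-facet G′-below path
    ... | no ¬G′-below with aG , bG , G-span@(G⊆ , _) ← facet-span G-facet =
      aG , bG , (G , G-facet , G-span) , ≤-<-trans (proj₁ (G⊆ y∈G)) y<a ,
      s≤s (subst (λ s → s + a ≤ bG) ∣G∩G′∣≡d (⊆[,⟩⇒∣∣+a≤b (IsSpan-bounded G-span) 0<∣G∩G′∣ G∩G′⊆))
      where
      ∣G∩G′∣≡d : ∣ G ∩ G′ ∣ ≡ d
      ∣G∩G′∣≡d = suc-injective (trans shared (facet-size G G-facet))
      0<∣G∩G′∣ = subst (0 <_) (sym ∣G∩G′∣≡d) (>-nonZero⁻¹ d {{d≢0}})
      G∩G′⊆ : G ∩ G′ ⊆[ a , bG ⟩
      G∩G′⊆ {x} x∈G∩G′ = let x∈G , x∈G′ = x∈p∩q⁻ G G′ x∈G∩G′ in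
        ≮⇒≥ (λ x<a → ¬G′-below (x , x∈G′ , x<a)) , proj₂ (G⊆ x∈G)

  facetSpan-family : NonZero d → StronglyConnected Δ → (∃ λ F → IsFacet Δ F) →
                     IntervalFamily n (suc d) n FacetSpan
  facetSpan-family d≢0 connected (F , F-facet) = record
    { long                 = λ (_ , G-facet , G-span) → facet-long G-facet G-span
    ; bounded              = λ (_ , _ , G-span) → IsSpan-bounded G-span
    ; m≤n                  = ≤-refl
    ; overlapped-from-left = overlapped-from-left d≢0 connected
    ; nonempty             = let a , b , F-span = facet-span F-facet in a , b , F , F-facet , F-span
    ; decidable            = λ a b → anySubset? λ G → isFacet? Δ? G ×-dec isSpan? G a b
    }

theorem4p4 : ∀ (n d : ℕ) → NonZero d → d < n →
    (Δ : Subset n → Set) → Decidable Δ →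
    IsSimplicialComplex Δ → HasVertexSetAll Δ →
    IsPureOfDim d Δ → StronglyConnected Δ → UnitIntervalOrder Δ →
    VertexDecomposable Δ
theorem4p4 n d d≢0 _ Δ Δ? (_ , closed) _ (facet , facet-size) connected unit-interval =
  VertexDecomposable-resp-≐ (swap (Δ≐IntervalComplex closed unit-interval))
    (IntervalComplex-vertexDecomposable n (suc d) (facetSpan-family d≢0 connected facet))
  where open FacetSpans Δ Δ? facet-size
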